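{- Let $n\geq 1$ and let $\pi=\pi_1\pi_2\cdots\pi_n$ be a Dumont permutation of length $n$ that avoids $132$, with $\pi_j=n$. Then one of the following holds: (1) if $n$ is odd, then $\pi=(\pi',n)$ (i.e. $j=n$), where $\pi'$ is a $132$-avoiding Dumont permutation of length $n-1$; (2) if $n$ is even, then $\pi=(\pi',n,\pi'')$, where $\pi'$ is an arrangement of the numbers $n-j+1,n-j+2,\dots,n-1$ satisfying the Dumont condition, $\pi''$ is a nonempty arrangement of the numbers $1,2,\dots,n-j$ satisfying the Dumont condition, and $j\in\{1\}\cup\{2,4,6,\dots,n-2\}$.
   Context: A permutation (or, more generally, an arrangement $\sigma_1\cdots\sigma_m$ of distinct positive integers) satisfies the Dumont condition, i.e. is a Dumont permutation (of the first kind), if every even entry $\sigma_i$ is followed by a smaller entry (so $i<m$ and $\sigma_{i+1}<\sigma_i$), and every odd entry $\sigma_i$ is either the last entry ($i=m$) or is followed by a larger entry ($\sigma_{i+1}>\sigma_i$). The empty arrangement counts as a Dumont permutation. A permutation $\pi$ contains the pattern $\tau\in S_k$ if $\pi$ has a subsequence $\pi_{i_1}\pi_{i_2}\cdots\pi_{i_k}$ ($i_1<\dots<i_k$) that is order-isomorphic to $\tau$; otherwise $\pi$ avoids $\tau$. $(\pi',n,\pi'')$ denotes concatenation. -}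

module Defs where

open import Data.Nat using (ℕ; zero; suc; _+_; _<_)
open import Data.Nat.Divisibility using (_∣_)
open import Data.List using (List; []; _∷_)
open import Data.List.Relation.Binary.Sublist.Propositional using (_⊆_)
open import Data.Product using (_×_; ∃-syntax)
open import Data.Unit using (⊤)
open import Relation.Nullary using (¬_)

Even : ℕ → Set
Even n = 2 ∣ n

Odd : ℕ → Set
Odd n = ¬ (2 ∣ n)

interval : ℕ → ℕ → List ℕ
interval a zero    = []
interval a (suc k) = a ∷ interval (suc a) k

Dumont : List ℕ → Set
Dumont []            = ⊤
Dumont (x ∷ [])      = Odd x
Dumont (x ∷ y ∷ r)   = (Even x → y < x) × (Odd x → x < y) × Dumont (y ∷ r)

Contains132 : List ℕ → Set
Contains132 π = ∃[ a ] ∃[ b ] ∃[ c ] ((a ∷ b ∷ c ∷ []) ⊆ π × a < c × c < b)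

Avoids132 : List ℕ → Set
Avoids132 π = ¬ Contains132 π

{-# OPTIONS --safe #-}
module Submission where

-- Because π avoids 132 and n separates π′ from π″, every entry of π′ exceeds every
-- entry of π″; hence π″ is a permutation of 1 … t and π′ of t+1 … n-1, where t = |π″|.
-- The Dumont condition forces an odd maximum to be last and an even one not to be.
-- When π′ ≠ [], its least entry t+1 is followed only by larger entries, so t+1 is odd;
-- for even n this makes j = n - t even, and t ≥ 2 (t is even and positive) gives j ≤ n - 2.

open import Defs
open import Data.Nat using (ℕ; zero; suc; _+_; _∸_; _≤_; _<_; z≤n; s≤s; _≤?_; _<?_)
open import Data.Nat.Properties
  using ( ≤-refl; ≤-trans; ≤-reflexive; <⇒≤; <⇒≢; <⇒≱; ≤⇒≯; ≮⇒≥; ≤∧≢⇒<; <-asym; m<m+n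
        ; m≤m+n; +-identityʳ; +-suc; +-comm; +-monoʳ-≤; ∸-monoˡ-≤; m+n∸m≡n; m+[n∸m]≡n)
open import Data.Nat.Divisibility using (divides; ∣-refl; ∣1⇒≡1; ∣m∣n⇒∣m+n; ∣m+n∣m⇒∣n)
open import Data.List using (List; []; _∷_; _++_; length; filter)
open import Data.List.Properties using (filter-++; filter-all; filter-none; length-++)
import Data.List.Properties as List
open import Data.List.Extrema.Nat using (min; min≤⊤; min≤xs; v≤min⁺; v<min⁺)
open import Data.List.Membership.Propositional using (_∈_)
open import Data.List.Membership.Propositional.Properties using (∈-++⁺ʳ)
open import Data.List.Relation.Unary.Any using (here; there)
open import Data.List.Relation.Unary.All as All using (All; []; _∷_)
open import Data.List.Relation.Unary.All.Properties using (++⁻ˡ; ++⁻ʳ)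
open import Data.List.Relation.Unary.Unique.Propositional using (Unique; []; _∷_)
open import Data.List.Relation.Binary.Sublist.Propositional using (_⊆_; _∷_; ⊆-refl; ⊆-trans; from∈)
open import Data.List.Relation.Binary.Sublist.Propositional.Properties using (++⁺; ++⁺ʳ)
open import Data.List.Relation.Binary.Permutation.Propositional using (_↭_; ↭-sym; ↭-trans; ↭⇒↭ₛ)
open import Data.List.Relation.Binary.Permutation.Propositional.Properties
  using (All-resp-↭; ∈-resp-↭; ↭-length; drop-mid; filter-↭; ++-comm)
import Data.List.Relation.Binary.Permutation.Propositional.Properties as ↭
open import Data.Product using (_×_; _,_; proj₁; proj₂; ∃-syntax)
open import Data.Sum using (_⊎_; inj₁; inj₂; [_,_]′)
open import Data.Empty using (⊥-elim)
open import Data.Unit using (tt)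
open import Function using (_∘_)
open import Relation.Nullary using (¬_)
open import Relation.Unary using (Pred; Decidable; ∁)
open import Relation.Binary.PropositionalEquality
  using (_≡_; _≢_; refl; sym; trans; cong; cong₂; subst; subst₂; setoid; ≢-sym; module ≡-Reasoning)
open import Data.List.Relation.Binary.Permutation.Setoid.Properties (setoid ℕ) using (Unique-resp-↭)

private
  variable
    a k n x y z : ℕ
    xs ys zs ws : List ℕ

interval-bounds : ∀ a k → All (λ x → a ≤ x × x < a + k) (interval a k)
interval-bounds a zero    = []
interval-bounds a (suc k) = (≤-refl , m<m+n a (s≤s z≤n)) ∷ All.map shift (interval-bounds (suc a) k)
  where
  shift : ∀ {x} → suc a ≤ x × x < suc a + k → a ≤ x × x < a + suc k
  shift {x} (a<x , x<) = <⇒≤ a<x , subst (x <_) (sym (+-suc a k)) x<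

interval-++ : ∀ a i j → interval a (i + j) ≡ interval a i ++ interval (a + i) j
interval-++ a zero    j = cong (λ b → interval b j) (sym (+-identityʳ a))
interval-++ a (suc i) j = cong (a ∷_) (begin
  interval (suc a) (i + j)                         ≡⟨ interval-++ (suc a) i j ⟩
  interval (suc a) i ++ interval (suc a + i) j     ≡⟨ cong (λ b → interval (suc a) i ++ interval b j) (sym (+-suc a i)) ⟩
  interval (suc a) i ++ interval (a + suc i) j     ∎)
  where open ≡-Reasoning

length-interval : ∀ a k → length (interval a k) ≡ k
length-interval a zero    = refl
length-interval a (suc k) = cong suc (length-interval (suc a) k)

interval-unique : ∀ a k → Unique (interval a k)
interval-unique a zero    = []
interval-unique a (suc k) = All.map (<⇒≢ ∘ proj₁) (interval-bounds (suc a) k) ∷ interval-unique (suc a) k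

↭-interval⇒length : xs ↭ interval a k → length xs ≡ k
↭-interval⇒length {a = a} {k} p = trans (↭-length p) (length-interval a k)

↭-interval⇒bounds : xs ↭ interval a k → All (λ x → a ≤ x × x < a + k) xs
↭-interval⇒bounds {a = a} {k} p = All-resp-↭ (↭-sym p) (interval-bounds a k)

↭-interval⇒least : 0 < k → xs ↭ interval a k → a ∈ xs × All (a ≤_) xs
↭-interval⇒least {suc k} _ p = ∈-resp-↭ (↭-sym p) (here refl) , All.map proj₁ (↭-interval⇒bounds p)

↭-interval-drop-last : xs ++ (a + k) ∷ ys ↭ interval a (suc k) → xs ++ ys ↭ interval a k
↭-interval-drop-last {xs} {a} {k} {ys} p =
  ↭-trans (drop-mid xs (interval a k) p′) (↭.++-identityʳ (interval a k))
  where
  p′ : xs ++ (a + k) ∷ ys ↭ interval a k ++ (a + k) ∷ []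
  p′ = subst (xs ++ (a + k) ∷ ys ↭_) (trans (cong (interval a) (+-comm 1 k)) (interval-++ a k 1)) p

filter-++-keeps-left : ∀ {p} {P : Pred ℕ p} (P? : Decidable P) →
                       All P xs → All (∁ P) ys → filter P? (xs ++ ys) ≡ xs
filter-++-keeps-left {xs} {ys} P? pxs ¬pys = begin
  filter P? (xs ++ ys)          ≡⟨ filter-++ P? xs ys ⟩
  filter P? xs ++ filter P? ys  ≡⟨ cong₂ _++_ (filter-all P? pxs) (filter-none P? ¬pys) ⟩
  xs ++ []                      ≡⟨ List.++-identityʳ xs ⟩
  xs                            ∎
  where open ≡-Reasoning

↭-filter-split : ∀ {p} {P : Pred ℕ p} (P? : Decidable P) → xs ++ ys ↭ zs ++ ws →
                 All P xs → All (∁ P) ys → All P zs → All (∁ P) ws → xs ↭ zs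
↭-filter-split P? p pxs ¬pys pzs ¬pws =
  subst₂ _↭_ (filter-++-keeps-left P? pxs ¬pys) (filter-++-keeps-left P? pzs ¬pws) (filter-↭ P? p)

↭-interval-split-at : ∀ a i j → xs ++ ys ↭ interval a (i + j) → All (a + i ≤_) xs → All (_< a + i) ys →
                      ys ↭ interval a i × xs ↭ interval (a + i) j
↭-interval-split-at {xs} {ys} a i j p xs≥ ys< =
    ↭-filter-split (_<? a + i) (↭-trans (++-comm ys xs) p′) ys< (All.map ≤⇒≯ xs≥) lower< (All.map ≤⇒≯ upper≥)
  , ↭-filter-split (a + i ≤?_) (↭-trans p′ (++-comm lower upper)) xs≥ (All.map <⇒≱ ys<) upper≥ (All.map <⇒≱ lower<)
  where
  lower = interval a i
  upper = interval (a + i) j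
  p′ : xs ++ ys ↭ lower ++ upper
  p′ = subst (xs ++ ys ↭_) (interval-++ a i j) p
  lower< : All (_< a + i) lower
  lower< = All.map proj₂ (interval-bounds a i)
  upper≥ : All (a + i ≤_) upper
  upper≥ = All.map proj₁ (interval-bounds (a + i) j)

separating-threshold : ∀ xs ys → xs ++ ys ↭ interval a k → (∀ {x y} → x ∈ xs → y ∈ ys → y < x) →
                       ∃[ i ] i ≤ k × All (a + i ≤_) xs × All (_< a + i) ys
separating-threshold {a} {k} xs ys p below =
  c ∸ a , i≤k , subst (λ b → All (b ≤_) xs) (sym a+i≡c) (min≤xs (a + k) xs)
              , subst (λ b → All (_< b) ys) (sym a+i≡c) (All.tabulate y<c)
  where
  c = min (a + k) xs
  bounds : All (λ x → a ≤ x × x < a + k) (xs ++ ys)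
  bounds = ↭-interval⇒bounds p
  a+i≡c : a + (c ∸ a) ≡ c
  a+i≡c = m+[n∸m]≡n (v≤min⁺ (m≤m+n a k) (All.map proj₁ (++⁻ˡ xs bounds)))
  i≤k : c ∸ a ≤ k
  i≤k = subst (c ∸ a ≤_) (m+n∸m≡n a k) (∸-monoˡ-≤ a (min≤⊤ (a + k) xs))
  y<c : ∀ {y} → y ∈ ys → y < c
  y<c y∈ = v<min⁺ (proj₂ (All.lookup (++⁻ʳ xs bounds) y∈)) (All.tabulate (λ x∈ → below x∈ y∈))

↭-interval-separated : ∀ xs ys → xs ++ ys ↭ interval a k → (∀ {x y} → x ∈ xs → y ∈ ys → y < x) →
                       ys ↭ interval a (length ys) × xs ↭ interval (a + length ys) (length xs)
↭-interval-separated {a} {k} xs ys p below with separating-threshold xs ys p below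
... | i , i≤k , xs≥ , ys< with ↭-interval-split-at a i (k ∸ i) p′ xs≥ ys<
  where
  p′ : xs ++ ys ↭ interval a (i + (k ∸ i))
  p′ = subst (λ m → xs ++ ys ↭ interval a m) (sym (m+[n∸m]≡n i≤k)) p
...   | ys↭ , xs↭ rewrite ↭-interval⇒length ys↭ | ↭-interval⇒length xs↭ = ys↭ , xs↭

Unique-++⇒≢ : Unique (xs ++ ys) → x ∈ xs → y ∈ ys → x ≢ y
Unique-++⇒≢ {_ ∷ xs} (x∉ ∷ _) (here refl) y∈ = All.lookup x∉ (∈-++⁺ʳ xs y∈)
Unique-++⇒≢ {_ ∷ xs} (_ ∷ u)  (there x∈) y∈ = Unique-++⇒≢ u x∈ y∈

Avoids132-⊆ : xs ⊆ ys → Avoids132 ys → Avoids132 xs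
Avoids132-⊆ xs⊆ys avoid (a , b , c , abc⊆ , a<c , c<b) = avoid (a , b , c , ⊆-trans abc⊆ xs⊆ys , a<c , c<b)

Avoids132-around-max : Unique (xs ++ ys) → All (_< n) ys → Avoids132 (xs ++ n ∷ ys) →
                       x ∈ xs → y ∈ ys → y < x
Avoids132-around-max {n = n} {x} {y} u ys<n avoid x∈ y∈ =
  ≤∧≢⇒< (≮⇒≥ x≮y) (≢-sym (Unique-++⇒≢ u x∈ y∈))
  where
  x≮y : ¬ x < y
  x≮y x<y = avoid (x , n , y , ++⁺ (from∈ x∈) (refl ∷ from∈ y∈) , x<y , All.lookup ys<n y∈)

Dumont-∷⁻ : ∀ xs → Dumont (x ∷ xs) → Dumont xs
Dumont-∷⁻ []      _           = tt
Dumont-∷⁻ (_ ∷ _) (_ , _ , d) = d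

Dumont-++⁻ʳ : ∀ xs → Dumont (xs ++ ys) → Dumont ys
Dumont-++⁻ʳ []       d = d
Dumont-++⁻ʳ (_ ∷ xs) d = Dumont-++⁻ʳ xs (Dumont-∷⁻ (xs ++ _) d)

Dumont-++⁻ˡ : ∀ xs → All (_< z) xs → Dumont (xs ++ z ∷ ys) → Dumont xs
Dumont-++⁻ˡ []           _            _                   = tt
Dumont-++⁻ˡ (x ∷ [])     (x<z ∷ [])   (even⇒desc , _ , _) = <-asym x<z ∘ even⇒desc
Dumont-++⁻ˡ (x ∷ w ∷ xs) (_ ∷ w∷xs<z) (even⇒desc , odd⇒asc , d) =
  even⇒desc , odd⇒asc , Dumont-++⁻ˡ (w ∷ xs) w∷xs<z d

Dumont-odd-maximum-last : Odd x → All (_< x) ys → Dumont (x ∷ ys) → ys ≡ []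
Dumont-odd-maximum-last odd []        _                 = refl
Dumont-odd-maximum-last odd (y<x ∷ _) (_ , odd⇒asc , _) = ⊥-elim (<-asym y<x (odd⇒asc odd))

Dumont-even-not-last : Even x → Dumont (x ∷ ys) → ys ≢ []
Dumont-even-not-last even d refl = d even

Dumont-least-odd : ∀ xs → Dumont (xs ++ z ∷ ys) → y ∈ xs → All (y ≤_) xs → y < z → Odd y
Dumont-least-odd (x ∷ [])     (even⇒desc , _) (here refl) _             y<z = <-asym y<z ∘ even⇒desc
Dumont-least-odd (x ∷ w ∷ xs) (even⇒desc , _) (here refl) (_ ∷ y≤w ∷ _) _  = λ even → <⇒≱ (even⇒desc even) y≤w
Dumont-least-odd (x ∷ xs)     d               (there y∈)  (_ ∷ y≤xs)    y<z =
  Dumont-least-odd xs (Dumont-∷⁻ (xs ++ _) d) y∈ y≤xs y<z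

even⊎even-suc : ∀ n → Even n ⊎ Even (suc n)
even⊎even-suc zero    = inj₁ (divides 0 refl)
even⊎even-suc (suc n) = [ inj₂ ∘ ∣m∣n⇒∣m+n ∣-refl , inj₁ ]′ (even⊎even-suc n)

odd-suc⇒even : Odd (suc n) → Even n
odd-suc⇒even {n} odd = [ (λ even → even) , ⊥-elim ∘ odd ]′ (even⊎even-suc n)

even-pos⇒≥2 : Even n → 0 < n → 2 ≤ n
even-pos⇒≥2 {suc zero}    even _ with ∣1⇒≡1 even
... | ()
even-pos⇒≥2 {suc (suc n)} _    _ = s≤s (s≤s z≤n)

even-split-position : ∀ p t → n ≡ suc (p + t) → Even n → 0 < t → (0 < p → Even t) →
                      suc p ≡ 1 ⊎ (Even (suc p) × 2 ≤ suc p × suc p ≤ n ∸ 2)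
even-split-position zero    t refl _    _   _         = inj₁ refl
even-split-position (suc p) t refl even t>0 least-odd =
  inj₂ (∣m+n∣m⇒∣n (subst Even (+-comm (suc (suc p)) t) even) even-t , s≤s (s≤s z≤n) , 2+p≤p+t)
  where
  even-t : Even t
  even-t = least-odd (s≤s z≤n)
  2+p≤p+t : 2 + p ≤ p + t
  2+p≤p+t = ≤-trans (≤-reflexive (+-comm 2 p)) (+-monoʳ-≤ p (even-pos⇒≥2 even-t t>0))

≢[]⇒length>0 : xs ≢ [] → 0 < length xs
≢[]⇒length>0 {[]}    xs≢[] = ⊥-elim (xs≢[] refl)
≢[]⇒length>0 {_ ∷ _} _     = s≤s z≤n

-- The maximum is suc n, so n here is the paper's n - 1.
module _ {n : ℕ} {π′ π″ : List ℕ}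
         (P : π′ ++ suc n ∷ π″ ↭ interval 1 (suc n))
         (D : Dumont (π′ ++ suc n ∷ π″))
         (A : Avoids132 (π′ ++ suc n ∷ π″)) where

  private
    P′ : π′ ++ π″ ↭ interval 1 n
    P′ = ↭-interval-drop-last P
    below : All (_< suc n) (π′ ++ π″)
    below = All.map proj₂ (↭-interval⇒bounds P′)
    π′-Dumont : Dumont π′
    π′-Dumont = Dumont-++⁻ˡ π′ (++⁻ˡ π′ below) D
    suffix-Dumont : Dumont (suc n ∷ π″)
    suffix-Dumont = Dumont-++⁻ʳ π′ D

  odd-maximum-last : Odd (suc n) → π″ ≡ [] × π′ ↭ interval 1 n × Dumont π′ × Avoids132 π′
  odd-maximum-last odd =
      π″≡[] , ↭-trans (↭-sym (↭.++-identityʳ π′)) (subst (λ ys → π′ ++ ys ↭ interval 1 n) π″≡[] P′)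
    , π′-Dumont , Avoids132-⊆ (++⁺ʳ (suc n ∷ π″) ⊆-refl) A
    where
    π″≡[] : π″ ≡ []
    π″≡[] = Dumont-odd-maximum-last odd (++⁻ʳ π′ below) suffix-Dumont

  private
    p = length π′
    t = length π″
    separated : π″ ↭ interval 1 t × π′ ↭ interval (1 + t) p
    separated = ↭-interval-separated π′ π″ P′
      (Avoids132-around-max (Unique-resp-↭ (↭⇒↭ₛ (↭-sym P′)) (interval-unique 1 n)) (++⁻ʳ π′ below) A)
    n≡p+t : n ≡ p + t
    n≡p+t = trans (sym (↭-interval⇒length P′)) (length-++ π′)
    n∸p≡t : n ∸ p ≡ t
    n∸p≡t = trans (cong (_∸ p) n≡p+t) (m+n∸m≡n p t)
    least-odd : 0 < p → Even t
    least-odd p>0 with ↭-interval⇒least p>0 (proj₂ separated)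
    ... | least∈ , least≤ =
      odd-suc⇒even (Dumont-least-odd π′ D least∈ least≤ (All.lookup (++⁻ˡ π′ below) least∈))

  even-maximum-split : Even (suc n) →
    π′ ↭ interval (n ∸ p + 1) p × Dumont π′ × π″ ≢ [] × π″ ↭ interval 1 (n ∸ p) × Dumont π″
    × (suc p ≡ 1 ⊎ (Even (suc p) × 2 ≤ suc p × suc p ≤ suc n ∸ 2))
  even-maximum-split even =
      subst (λ b → π′ ↭ interval b p) (sym (trans (cong (_+ 1) n∸p≡t) (+-comm t 1))) (proj₂ separated)
    , π′-Dumont , π″≢[]
    , subst (λ m → π″ ↭ interval 1 m) (sym n∸p≡t) (proj₁ separated)
    , Dumont-∷⁻ π″ suffix-Dumont
    , even-split-position p t (cong suc n≡p+t) even (≢[]⇒length>0 π″≢[]) least-odd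
    where
    π″≢[] : π″ ≢ []
    π″≢[] = Dumont-even-not-last even suffix-Dumont

proposition2p1 : (n : ℕ) (π′ π″ : List ℕ) → 1 ≤ n
    → (π′ ++ n ∷ π″) ↭ interval 1 n
    → Dumont (π′ ++ n ∷ π″)
    → Avoids132 (π′ ++ n ∷ π″)
    → (Odd n → π″ ≡ [] × π′ ↭ interval 1 (n ∸ 1) × Dumont π′ × Avoids132 π′)
      × (Even n → π′ ↭ interval (n ∸ suc (length π′) + 1) (suc (length π′) ∸ 1)
           × Dumont π′
           × π″ ≢ []
           × π″ ↭ interval 1 (n ∸ suc (length π′))
           × Dumont π″
           × (suc (length π′) ≡ 1
              ⊎ (Even (suc (length π′)) × 2 ≤ suc (length π′) × suc (length π′) ≤ n ∸ 2)))
proposition2p1 (suc n) π′ π″ _ P D A = odd-maximum-last P D A , even-maximum-split P D A
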